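{- Let $P$ be an RB-template and $P^{\multimap}$ its reachability-unwinding. For every $n\in\mathbb{N}$, the set of runs of the RB-system $P^n$ equals $\{\rho^{\circledcirc}:\rho\text{ a run of }(P^{\multimap})^n\}$.
   Context: Fix $k\ge1$, finite $\Sigma_{actn}$, $\Sigma_{rdz}=\{a_1,\dots,a_k:a\in\Sigma_{actn}\}$ and broadcast symbol $\mathfrak{b}$. An RB-template is a finite LTS $P=(AP,\Sigma_{rdz}\cup\{\mathfrak{b}\},S,I,R,\lambda)$ with an outgoing $\mathfrak{b}$-edge from every state. The RB-system $P^n$ has configurations $f:[n]\to S$, initial ones with all $f(i)\in I$, broadcast transitions $(f,\mathfrak{b},g)$ with $(f(i),\mathfrak{b},g(i))\in R$ for all $i$, and rendezvous transitions $(f,((i_1,a_1),\dots,(i_k,a_k)),g)$ with $i_1,\dots,i_k$ pairwise distinct, $(f(i_j),a_j,g(i_j))\in R$ for all $j$, and $f(i)=g(i)$ otherwise. A run is a finite or infinite sequence of consecutive transitions starting in an initial configuration. Reachability-unwinding: define $I_0=I$; given $I_i$, let $S_i,R_i$ be the least sets with $I_i\subseteq S_i$, $R_i$ a set of rendezvous edges of $R$, closed under: if $(s,a_h,t)\in R$ with $s\in S_i$ and for every $l\in[k]\setminus\{h\}$ there is an edge $(s',a_l,t')\in R$ with $s'\in S_i$, then $(s,a_h,t)\in R_i$ and $t\in S_i$. Let $I_{i+1}=\{s:(h,\mathfrak{b},s)\in R\text{ for some }h\in S_i\}$. Let $m$ be least such that $I_{m+1}=I_n$ for some $n\le m$. $P^{\multimap}$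 has states $\{(s,i):0\le i\le m, s\in S_i\}$, initial states $\{(s,0):s\in I\}$, labeling $\lambda^{\multimap}(s,i)=\lambda(s)$, rendezvous edges $((s,i),\sigma,(t,i))$ for $(s,\sigma,t)\in R_i$, and broadcast edges $((s,i),\mathfrak{b},(t,i+1))$ for $i<m$, $s\in S_i$, $(s,\mathfrak{b},t)\in R$, and $((s,m),\mathfrak{b},(t,n))$ for $s\in S_m$, $(s,\mathfrak{b},t)\in R$. Winding: for a configuration $\mathfrak{f}$ of $(P^{\multimap})^n$, $\mathfrak{f}^{\circledcirc}(i)=s$ where $\mathfrak{f}(i)=(s,j)$; a transition $(\mathfrak{f},\sigma,\mathfrak{g})$ winds to $(\mathfrak{f}^{\circledcirc},\sigma,\mathfrak{g}^{\circledcirc})$, and runs wind transition-wise. -}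

module Defs where

open import Data.Nat using (ℕ; zero; suc; _≤_; _<_)
open import Data.Fin using (Fin; toℕ)
open import Data.Bool using (Bool)
open import Data.Vec using (Vec; lookup; map)
open import Data.List using (List; []; _∷_)
open import Data.Product using (Σ; ∃; ∃-syntax; _×_; _,_; proj₁)
open import Data.Sum using (_⊎_; inj₁; inj₂)
open import Relation.Binary.PropositionalEquality using (_≡_; _≢_)
open import Relation.Nullary using (¬_)

-- Symbols.  Σ_actn = Fin A (a finite set); Σ_rdz = {a_j : a ∈ Σ_actn, j ∈ [k]}
-- (index j ranges over Fin k, i.e. j = 1..k is written 0..k-1); 𝔟 = broadcast.

data Sym (k A : ℕ) : Set where
  rdz : Fin A → Fin k → Sym k A
  𝔟   : Sym k A

record LTS (k A : ℕ) (St : Set) : Set₁ where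
  field
    AP  : Set
    I   : St → Set
    R   : St → Sym k A → St → Set
    lab : St → AP → Bool

record Template (k A N : ℕ) : Set₁ where
  field
    lts    : LTS k A (Fin N)
  open LTS lts public
  field
    bTotal : ∀ s → ∃[ t ] R s 𝔟 t

-- global transition labels: 𝔟, or ((i_1,a_1),…,(i_k,a_k)) given by the
-- common action a and the vector of process indices (i_1,…,i_k)
data GLab (k A n : ℕ) : Set where
  gb   : GLab k A n
  grdz : Fin A → Vec (Fin n) k → GLab k A n

module RBSystem {k A : ℕ} {St : Set} (P : LTS k A St) (n : ℕ) where
  open LTS P

  Config : Set
  Config = Vec St n

  Initial : Config → Set
  Initial f = ∀ i → I (lookup f i)

  Step : Config → GLab k A n → Config → Set
  Step f gb g = ∀ i → R (lookup f i) 𝔟 (lookup g i)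
  Step f (grdz a is) g =
      (∀ j j′ → lookup is j ≡ lookup is j′ → j ≡ j′)
    × (∀ j → R (lookup f (lookup is j)) (rdz a j) (lookup g (lookup is j)))
    × (∀ i → (∀ j → lookup is j ≢ i) → lookup f i ≡ lookup g i)

  record Trans : Set where
    constructor tr
    field
      src : Config
      σ   : GLab k A n
      tgt : Config
  open Trans public

  IsTrans : Trans → Set
  IsTrans (tr f σ g) = Step f σ g

  Seq : Set
  Seq = List Trans ⊎ (ℕ → Trans)

  private
    ConsecFrom : Trans → List Trans → Set
    ConsecFrom t [] = IsTrans t
    ConsecFrom t (t′ ∷ ts) = IsTrans t × tgt t ≡ src t′ × ConsecFrom t′ ts

  IsRun : Seq → Set
  IsRun (inj₁ []) = Data.Unit.⊤
    where import Data.Unit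
  IsRun (inj₁ (t ∷ ts)) = Initial (src t) × ConsecFrom t ts
  IsRun (inj₂ ρ) = Initial (src (ρ 0))
                 × (∀ j → IsTrans (ρ j))
                 × (∀ j → tgt (ρ j) ≡ src (ρ (suc j)))

module _ {T : Set} where
  _≈Seq_ : List T ⊎ (ℕ → T) → List T ⊎ (ℕ → T) → Set
  inj₁ xs ≈Seq inj₁ ys = xs ≡ ys
  inj₂ ρ  ≈Seq inj₂ ρ′ = ∀ j → ρ j ≡ ρ′ j
  _       ≈Seq _       = Data.Empty.⊥
    where import Data.Empty

module Unwinding {k A N : ℕ} (P : Template k A N) where
  open Template P

  St : Set
  St = Fin N

  data Reach (J : St → Set) : St → Set where
    init : ∀ {s} → J s → Reach J s
    step : ∀ {s a h t} → Reach J s → R s (rdz a h) t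
         → (∀ l → l ≢ h → ∃[ s′ ] ∃[ t′ ] (Reach J s′ × R s′ (rdz a l) t′))
         → Reach J t

  REdge : (St → Set) → St → Sym k A → St → Set
  REdge J s (rdz a h) t = Reach J s × R s (rdz a h) t
                        × (∀ l → l ≢ h → ∃[ s′ ] ∃[ t′ ] (Reach J s′ × R s′ (rdz a l) t′))
  REdge J s 𝔟 t = Data.Empty.⊥
    where import Data.Empty

  Ii : ℕ → St → Set
  Ii zero = I
  Ii (suc i) s = ∃[ h ] (Reach (Ii i) h × R h 𝔟 s)

  Si : ℕ → St → Set
  Si i = Reach (Ii i)

  Ri : ℕ → St → Sym k A → St → Set
  Ri i = REdge (Ii i)

  SameSet : (St → Set) → (St → Set) → Set
  SameSet X Y = ∀ s → (X s → Y s) × (Y s → X s)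

  IsUnwindIndex : ℕ → ℕ → Set
  IsUnwindIndex m n = n ≤ m × SameSet (Ii (suc m)) (Ii n)
                    × (∀ m′ n′ → m′ < m → n′ ≤ m′ → ¬ SameSet (Ii (suc m′)) (Ii n′))

  record UState (m : ℕ) : Set where
    constructor ust
    field
      lvl : Fin (suc m)
      st  : St
      mem : Si (toℕ lvl) st
  open UState public

  data UR (m n : ℕ) : UState m → Sym k A → UState m → Set where
    urdz : ∀ {i s p t q a h} → Ri (toℕ i) s (rdz a h) t
         → UR m n (ust i s p) (rdz a h) (ust i t q)
    ubc  : ∀ {i s p j t q} → toℕ i < m → toℕ j ≡ suc (toℕ i) → R s 𝔟 t
         → UR m n (ust i s p) 𝔟 (ust j t q)
    ubcm : ∀ {i s p j t q} → toℕ i ≡ m → toℕ j ≡ n → R s 𝔟 t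
         → UR m n (ust i s p) 𝔟 (ust j t q)

  UI : (m : ℕ) → UState m → Set
  UI m (ust i s _) = toℕ i ≡ 0 × I s

  Unwind : (m n : ℕ) → LTS k A (UState m)
  Unwind m n = record { AP = AP ; I = UI m ; R = UR m n ; lab = λ u → lab (st u) }

  module _ (m n c : ℕ) where
    private
      module U = RBSystem (Unwind m n) c
      module O = RBSystem lts c

    windC : U.Config → O.Config
    windC f = map st f

    windT : U.Trans → O.Trans
    windT (U.tr f σ g) = O.tr (windC f) σ (windC g)

    windR : U.Seq → O.Seq
    windR (inj₁ ts) = inj₁ (Data.List.map windT ts)
    windR (inj₂ ρ)  = inj₂ (λ j → windT (ρ j))

-- A run of P^n is lifted to (P^⊸)^n by tagging all processes with one common
-- unwinding level ℓ, maintaining that every process sits in S_ℓ: a rendezvous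
-- only fires edges that S_ℓ is closed under, so it stays at level ℓ and uses
-- edges of R_ℓ, while a broadcast moves every process into I_{ℓ+1} ⊆ S_{ℓ+1}
-- (or into I_{m+1} = I_n′ ⊆ S_n′ from the last level m).  Conversely, every
-- edge of P^⊸ winds to an edge of P, so wound runs are runs.
module Submission where

open import Defs
open import Data.Nat using (ℕ; zero; suc; _≤_; _<?_; s≤s)
open import Data.Nat.Properties using (≤-antisym; ≮⇒≥)
open import Data.Fin using (Fin; toℕ; fromℕ<; _≟_)
import Data.Fin as Fin
open import Data.Fin.Properties using (any?; toℕ-fromℕ<; toℕ≤pred[n])
open import Data.Vec using (lookup; tabulate; map)
open import Data.Vec.Properties using (lookup∘tabulate; lookup-map; tabulate∘lookup; tabulate-∘)
open import Data.List using (List; []; _∷_)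
import Data.List as List
open import Data.Product using (Σ-syntax; ∃-syntax; _×_; _,_; proj₁; proj₂)
open import Data.Sum using (inj₁; inj₂)
open import Data.Unit using (tt)
open import Data.Empty using (⊥-elim)
open import Relation.Nullary using (yes; no)
open import Relation.Binary.PropositionalEquality
open import Function.Bundles using (_⇔_; mk⇔)

module Runs {k A : ℕ} {St : Set} (P : LTS k A St) (n : ℕ) where
  open RBSystem P n public

  -- The consecutiveness predicate inside IsRun is private to Defs; it is
  -- recovered here as the second factor of IsRun on a nonempty list.
  private
    run-split : ∀ t ts → Σ[ C ∈ Set ] IsRun (inj₁ (t ∷ ts)) ≡ (Initial (src t) × C)
    run-split t ts = _ , refl

  Consecutive : Trans → List Trans → Set
  Consecutive t ts = proj₁ (run-split t ts)

  consecutive-head : ∀ t ts → Consecutive t ts → IsTrans t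
  consecutive-head t []      c           = c
  consecutive-head t (_ ∷ _) (s , _ , _) = s

  IsRun-respects-≈Seq : ∀ {ρ ρ′} → ρ ≈Seq ρ′ → IsRun ρ′ → IsRun ρ
  IsRun-respects-≈Seq {inj₁ _} {inj₁ _} refl r = r
  IsRun-respects-≈Seq {inj₂ ρ} {inj₂ ρ′} e (i , s , c) =
      subst Initial (sym (cong src (e 0))) i
    , (λ j → subst IsTrans (sym (e j)) (s j))
    , λ j → trans (cong tgt (e j)) (trans (c j) (sym (cong src (e (suc j)))))

module Projection {k A : ℕ} {S T : Set} (P : LTS k A S) (Q : LTS k A T) (π : T → S) (n : ℕ) where
  private
    module P = Runs P n
    module Q = Runs Q n

  projectTrans : Q.Trans → P.Trans
  projectTrans (Q.tr f σ g) = P.tr (map π f) σ (map π g)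

  projectSeq : Q.Seq → P.Seq
  projectSeq (inj₁ ts) = inj₁ (List.map projectTrans ts)
  projectSeq (inj₂ ρ)  = inj₂ (λ j → projectTrans (ρ j))

  module Morphism (π-initial : ∀ u → LTS.I Q u → LTS.I P (π u))
                  (π-edge : ∀ {u a v} → LTS.R Q u a v → LTS.R P (π u) a (π v)) where

    private
      lookup-π : ∀ (f : Q.Config) i → lookup (map π f) i ≡ π (lookup f i)
      lookup-π f i = lookup-map i π f

      π-edge′ : ∀ f g {a} i j → LTS.R Q (lookup f i) a (lookup g j)
              → LTS.R P (lookup (map π f) i) a (lookup (map π g) j)
      π-edge′ f g {a} i j r =
        subst₂ (λ x y → LTS.R P x a y) (sym (lookup-π f i)) (sym (lookup-π g j)) (π-edge r)

    project-initial : ∀ f → Q.Initial f → P.Initial (map π f)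
    project-initial f h i = subst (LTS.I P) (sym (lookup-π f i)) (π-initial (lookup f i) (h i))

    project-step : ∀ f σ g → Q.Step f σ g → P.Step (map π f) σ (map π g)
    project-step f gb g s i = π-edge′ f g i i (s i)
    project-step f (grdz a is) g (distinct , moves , frame) =
        distinct
      , (λ j → π-edge′ f g (lookup is j) (lookup is j) (moves j))
      , λ i idle → trans (lookup-π f i) (trans (cong π (frame i idle)) (sym (lookup-π g i)))

    project-trans : ∀ t → Q.IsTrans t → P.IsTrans (projectTrans t)
    project-trans (Q.tr f σ g) = project-step f σ g

    project-consecutive : ∀ t ts → Q.Consecutive t ts
                        → P.Consecutive (projectTrans t) (List.map projectTrans ts)
    project-consecutive t []        s           = project-trans t s
    project-consecutive t (t′ ∷ ts) (s , e , c) =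
      project-trans t s , cong (map π) e , project-consecutive t′ ts c

    project-run : ∀ ρ → Q.IsRun ρ → P.IsRun (projectSeq ρ)
    project-run (inj₁ [])       _           = tt
    project-run (inj₁ (t ∷ ts)) (i , c)     = project-initial (Q.src t) i , project-consecutive t ts c
    project-run (inj₂ ρ)        (i , s , c) =
      project-initial (Q.src (ρ 0)) i , (λ j → project-trans (ρ j) (s j)) , λ j → cong (map π) (c j)

  module Lifting
    (Liftable : P.Config → Set)
    (lift : ∀ f → Liftable f → Q.Config)
    (project-lift : ∀ f L → map π (lift f L) ≡ f)
    (lift-initial : ∀ f → P.Initial f → Σ[ L ∈ Liftable f ] Q.Initial (lift f L))
    (lift-step : ∀ f σ g → P.Step f σ g → (L : Liftable f)
               → Σ[ L′ ∈ Liftable g ] Q.Step (lift f L) σ (lift g L′)) where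

    private
      next : ∀ t → P.IsTrans t → Liftable (P.src t) → Liftable (P.tgt t)
      next (P.tr f σ g) s L = proj₁ (lift-step f σ g s L)

      liftTrans : ∀ t → P.IsTrans t → Liftable (P.src t) → Q.Trans
      liftTrans t s L = Q.tr (lift (P.src t) L) (P.σ t) (lift (P.tgt t) (next t s L))

      liftTrans-ok : ∀ t s L → Q.IsTrans (liftTrans t s L)
      liftTrans-ok (P.tr f σ g) s L = proj₂ (lift-step f σ g s L)

      project-liftTrans : ∀ t s L → projectTrans (liftTrans t s L) ≡ t
      project-liftTrans t s L =
        cong₂ (λ f g → P.tr f (P.σ t) g) (project-lift _ L) (project-lift _ (next t s L))

      lift-subst : ∀ {f g} (e : f ≡ g) L → lift f L ≡ lift g (subst Liftable e L)
      lift-subst refl L = refl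

      liftTail : ∀ t ts L (c : P.Consecutive t ts) → List Q.Trans
      liftTail t []        L _           = []
      liftTail t (t′ ∷ ts) L (s , e , c) =
        liftTrans t′ (P.consecutive-head t′ ts c) L′ ∷ liftTail t′ ts L′ c
        where L′ = subst Liftable e (next t s L)

      liftTail-ok : ∀ t ts L (c : P.Consecutive t ts)
                  → Q.Consecutive (liftTrans t (P.consecutive-head t ts c) L) (liftTail t ts L c)
      liftTail-ok t []        L c           = liftTrans-ok t c L
      liftTail-ok t (t′ ∷ ts) L (s , e , c) =
        liftTrans-ok t s L , lift-subst e (next t s L) , liftTail-ok t′ ts _ c

      project-liftTail : ∀ t ts L (c : P.Consecutive t ts)
                       → List.map projectTrans (liftTail t ts L c) ≡ ts
      project-liftTail t []        L c           = refl
      project-liftTail t (t′ ∷ ts) L (s , e , c) =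
        cong₂ _∷_ (project-liftTrans t′ _ _) (project-liftTail t′ ts _ c)

    lift-run : ∀ ρ → P.IsRun ρ → ∃[ ρ′ ] (Q.IsRun ρ′ × ρ ≈Seq projectSeq ρ′)
    lift-run (inj₁ [])       _       = inj₁ [] , tt , refl
    lift-run (inj₁ (t ∷ ts)) (i , c) =
        inj₁ (liftTrans t s L ∷ liftTail t ts L c)
      , (Lᵢ , liftTail-ok t ts L c)
      , sym (cong₂ _∷_ (project-liftTrans t s L) (project-liftTail t ts L c))
      where
        s = P.consecutive-head t ts c
        L = proj₁ (lift-initial (P.src t) i)
        Lᵢ = proj₂ (lift-initial (P.src t) i)
    lift-run (inj₂ ρ) (i , s , c) =
        inj₂ (λ j → liftTrans (ρ j) (s j) (Ls j))
      , (proj₂ (lift-initial (P.src (ρ 0)) i)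
        , (λ j → liftTrans-ok (ρ j) (s j) (Ls j))
        , λ j → lift-subst (c j) _)
      , λ j → sym (project-liftTrans (ρ j) (s j) (Ls j))
      where
        Ls : ∀ j → Liftable (P.src (ρ j))
        Ls zero    = proj₁ (lift-initial (P.src (ρ 0)) i)
        Ls (suc j) = subst Liftable (c j) (next (ρ j) (s j) (Ls j))

module UnwindingRuns {k A N : ℕ} (P : Template k A N) (m n′ : ℕ)
                     (index : Unwinding.IsUnwindIndex P m n′) where
  open Template P
  open Unwinding P

  unwound-initial : ∀ u → UI m u → I (st u)
  unwound-initial _ = proj₂

  unwound-edge : ∀ {u a v} → UR m n′ u a v → R (st u) a (st v)
  unwound-edge (urdz (_ , r , _)) = r
  unwound-edge (ubc _ _ r)        = r
  unwound-edge (ubcm _ _ r)       = r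

  Lvl : Set
  Lvl = Fin (suc m)

  record BroadcastSuccessor (ℓ : Lvl) : Set where
    field
      level : Lvl
      reach : ∀ {s t} → Si (toℕ ℓ) s → R s 𝔟 t → Si (toℕ level) t
      edge  : ∀ {s p t q} → R s 𝔟 t → UR m n′ (ust ℓ s p) 𝔟 (ust level t q)

  private
    at-fromℕ< : ∀ {i s} (i≤m : i ≤ m) → Si i s → Si (toℕ (fromℕ< (s≤s i≤m))) s
    at-fromℕ< {s = s} i≤m = subst (λ x → Si x s) (sym (toℕ-fromℕ< (s≤s i≤m)))

  broadcast-successor : ∀ ℓ → BroadcastSuccessor ℓ
  broadcast-successor ℓ with toℕ ℓ <? m
  ... | yes ℓ<m = record
    { level = fromℕ< (s≤s ℓ<m)
    ; reach = λ p r → at-fromℕ< ℓ<m (init (_ , p , r))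
    ; edge  = ubc ℓ<m (toℕ-fromℕ< (s≤s ℓ<m))
    }
  ... | no ℓ≮m = record
    { level = fromℕ< (s≤s n′≤m)
    ; reach = λ p r → at-fromℕ< n′≤m
                (init (proj₁ (wraps _) (_ , subst (λ x → Si x _) ℓ≡m p , r)))
    ; edge  = ubcm ℓ≡m (toℕ-fromℕ< (s≤s n′≤m))
    }
    where
      n′≤m : n′ ≤ m
      n′≤m = proj₁ index
      wraps : SameSet (Ii (suc m)) (Ii n′)
      wraps = proj₁ (proj₂ index)
      ℓ≡m : toℕ ℓ ≡ m
      ℓ≡m = ≤-antisym (toℕ≤pred[n] ℓ) (≮⇒≥ ℓ≮m)

  module System (n : ℕ) where
    private
      module O = Runs lts n
      module U = Runs (Unwind m n′) n

    AtLevel : Lvl → O.Config → Set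
    AtLevel ℓ f = ∀ i → Si (toℕ ℓ) (lookup f i)

    Levelled : O.Config → Set
    Levelled f = Σ[ ℓ ∈ Lvl ] AtLevel ℓ f

    liftState : ∀ f → Levelled f → Fin n → UState m
    liftState f (ℓ , G) i = ust ℓ (lookup f i) (G i)

    lift : ∀ f → Levelled f → U.Config
    lift f L = tabulate (liftState f L)

    wind-lift : ∀ f L → map st (lift f L) ≡ f
    wind-lift f L = trans (sym (tabulate-∘ st (liftState f L))) (tabulate∘lookup f)

    lift-edge : ∀ {a} f L g L′ i j → UR m n′ (liftState f L i) a (liftState g L′ j)
              → UR m n′ (lookup (lift f L) i) a (lookup (lift g L′) j)
    lift-edge {a} f L g L′ i j =
      subst₂ (λ x y → UR m n′ x a y) (sym (lookup∘tabulate _ i)) (sym (lookup∘tabulate _ j))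

    lift-initial : ∀ f → O.Initial f → Σ[ L ∈ Levelled f ] U.Initial (lift f L)
    lift-initial f h = (Fin.zero , λ i → init (h i))
                     , λ i → subst (UI m) (sym (lookup∘tabulate _ i)) (refl , h i)

    module Rendezvous {f g a is} (s : O.Step f (grdz a is) g) {ℓ} (G : AtLevel ℓ f) where

      fires : ∀ j → Ri (toℕ ℓ) (lookup f (lookup is j)) (rdz a j) (lookup g (lookup is j))
      fires j = G (lookup is j) , moves j , λ l _ → _ , _ , G (lookup is l) , moves l
        where moves = proj₁ (proj₂ s)

      stays : AtLevel ℓ g
      stays i with any? (λ j → lookup is j ≟ i)
      ... | yes (j , refl) = let (p , r , partners) = fires j in step p r partners
      ... | no idle        = subst (Si (toℕ ℓ)) (proj₂ (proj₂ s) i λ j e → idle (j , e)) (G i)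

      idle-fixed : ∀ i → (∀ j → lookup is j ≢ i)
                 → ust ℓ (lookup f i) (G i) ≡ ust ℓ (lookup g i) (stays i)
      idle-fixed i idle with any? (λ j → lookup is j ≟ i)
      ... | yes (j , e) = ⊥-elim (idle j e)
      ... | no _        = ust-subst (proj₂ (proj₂ s) i _) (G i)
        where
          ust-subst : ∀ {x y} (e : x ≡ y) p → ust ℓ x p ≡ ust ℓ y (subst (Si (toℕ ℓ)) e p)
          ust-subst refl p = refl

    lift-step : ∀ f σ g → O.Step f σ g → (L : Levelled f)
              → Σ[ L′ ∈ Levelled g ] U.Step (lift f L) σ (lift g L′)
    lift-step f gb g s L@(ℓ , G) =
      L′ , λ i → lift-edge f L g L′ i i (edge (s i))
      where
        open BroadcastSuccessor (broadcast-successor ℓ)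
        L′ : Levelled g
        L′ = level , λ i → reach (G i) (s i)
    lift-step f (grdz a is) g s@(distinct , _ , _) L@(ℓ , G) =
        L′
      , distinct
      , (λ j → lift-edge f L g L′ (lookup is j) (lookup is j) (urdz (fires j)))
      , λ i idle → trans (lookup∘tabulate _ i)
                     (trans (idle-fixed i idle) (sym (lookup∘tabulate _ i)))
      where
        open Rendezvous {f} {g} {a} {is} s {ℓ} G
        L′ : Levelled g
        L′ = ℓ , stays

    open Projection lts (Unwind m n′) st n public
    open Morphism unwound-initial unwound-edge public
    open Lifting Levelled lift wind-lift lift-initial lift-step public

    wind-is-projection : ∀ ρ → windR m n′ n ρ ≡ projectSeq ρ
    wind-is-projection (inj₁ _) = refl
    wind-is-projection (inj₂ _) = refl

    runs-unwind : ∀ ρ → O.IsRun ρ → ∃[ ρ′ ] (U.IsRun ρ′ × ρ ≈Seq windR m n′ n ρ′)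
    runs-unwind ρ r with lift-run ρ r
    ... | ρ′ , r′ , e = ρ′ , r′ , subst (ρ ≈Seq_) (sym (wind-is-projection ρ′)) e

    wound-runs-are-runs : ∀ ρ → ∃[ ρ′ ] (U.IsRun ρ′ × ρ ≈Seq windR m n′ n ρ′) → O.IsRun ρ
    wound-runs-are-runs ρ (ρ′ , r′ , e) =
      O.IsRun-respects-≈Seq (subst (ρ ≈Seq_) (wind-is-projection ρ′) e) (project-run ρ′ r′)

lemma5p6 : ∀ {k A N : ℕ} → 1 ≤ k → (P : Template k A N)
         → (m n′ : ℕ) → Unwinding.IsUnwindIndex P m n′
         → (n : ℕ) (ρ : RBSystem.Seq (Template.lts P) n)
         → RBSystem.IsRun (Template.lts P) n ρ
           ⇔ (∃[ ρ′ ] (RBSystem.IsRun (Unwinding.Unwind P m n′) n ρ′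
                       × ρ ≈Seq Unwinding.windR P m n′ n ρ′))
lemma5p6 _ P m n′ index n ρ = mk⇔ (runs-unwind ρ) (wound-runs-are-runs ρ)
  where open UnwindingRuns.System P m n′ index n
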